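{- Let $(x_1,y_1),\dots,(x_m,y_m)$ be data with $x_i\in[N]$ and $y_i\in\{ -1,+1\}$. For any splits $j<j'$ in $[N]$, let $\ell=|\{i: j<x_i\le j'\}|$. Then $|L_{\mathrm{Gini}}(j)-L_{\mathrm{Gini}}(j')|\le 2\ell/m$.
   Context: For an interval $R\subseteq[N]$, $f_{+1,R}$ and $f_{ -1,R}$ are the numbers of data points with $x_i\in R$ and label $+1$, resp. $-1$. For split $j$, with $a=f_{+1,[1,j]}$, $b=f_{ -1,[1,j]}$, $c=f_{+1,[j+1,N]}$, $d=f_{ -1,[j+1,N]}$, the Gini loss is $L_{\mathrm{Gini}}(j)=\frac{2ab}{m(a+b)}+\frac{2cd}{m(c+d)}$, where a term with zero denominator (empty side) is $0$. Equivalently it is $\frac{|L_j|}{m}\mathrm{Gini}(\{y_i:x_i\le j\})+\frac{|R_j|}{m}\mathrm{Gini}(\{y_i:x_i>j\})$ with $\mathrm{Gini}(S)=1-\sum_y(|S_y|/|S|)^2$, $\mathrm{Gini}(\emptyset)=0$, and $|L_j|,|R_j|$ the numbers of points on each side. -}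

module Defs where

open import Data.Nat as ℕ using (ℕ; zero; suc; _+_; _*_; _≤_; _<_; _≤ᵇ_; _<ᵇ_)
open import Data.Bool using (Bool; true; false; if_then_else_; _∧_)
open import Data.Fin using (Fin)
open import Data.List using (List; filter; length; allFin; map)
open import Data.Sign using (Sign)
open import Data.Integer using (+_)
open import Data.Rational as ℚ using (ℚ; 0ℚ)
open import Relation.Binary.PropositionalEquality using (_≡_)
open import Relation.Nullary.Decidable using (⌊_⌋)
import Data.Sign.Properties as SignP

-- A data set of m points: point i has feature x i ∈ [N] = {1,…,N}
-- (the bound is imposed as a hypothesis in the statement) and label y i ∈ {-1,+1},
-- with Sign.- standing for -1 and Sign.+ for +1.

countIn : {m : ℕ} → (Fin m → ℕ) → (Fin m → Sign) → Sign → ℕ → ℕ → ℕ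
countIn {m} x y s lo hi =
  length (filter (λ i → (lo ℕ.<? x i) Relation.Nullary.Decidable.×-dec (x i ℕ.≤? hi)
                          Relation.Nullary.Decidable.×-dec (y i SignP.≟ s))
                 (allFin m))

countPts : {m : ℕ} → (Fin m → ℕ) → ℕ → ℕ → ℕ
countPts {m} x lo hi =
  length (filter (λ i → (lo ℕ.<? x i) Relation.Nullary.Decidable.×-dec (x i ℕ.≤? hi)) (allFin m))

-- p / q as a rational, with the convention that a zero denominator gives 0
frac : ℕ → ℕ → ℚ
frac p zero    = 0ℚ
frac p (suc q) = (+ p) ℚ./ suc q

-- Gini loss of split j on a data set of m points with features in [N]:
-- a = f_{+1,[1,j]}, b = f_{-1,[1,j]}, c = f_{+1,[j+1,N]}, d = f_{-1,[j+1,N]},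
-- L(j) = 2ab/(m(a+b)) + 2cd/(m(c+d)), a zero-denominator term being 0.
giniLoss : {m : ℕ} → (N : ℕ) → (Fin m → ℕ) → (Fin m → Sign) → ℕ → ℚ
giniLoss {m} N x y j =
  let a = countIn x y Sign.+ 0 j
      b = countIn x y Sign.- 0 j
      c = countIn x y Sign.+ j N
      d = countIn x y Sign.- j N
  in frac (2 * a * b) (m * (a + b)) ℚ.+ frac (2 * c * d) (m * (c + d))

{-# OPTIONS --safe #-}
-- Moving the split from j to j′ transfers the ℓ points of (j, j′] from the right side to
-- the left one. The weighted Gini term 2ab / (m (a + b)) of a side is monotone in both
-- counts, and adding p + q points raises it by at most 2 (p + q) / m. So the left term
-- grows and the right term shrinks, each by an amount in [0, 2ℓ/m], and the difference
-- of two numbers in [0, 2ℓ/m] is at most 2ℓ/m.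
module Submission where

open import Defs
open import Algebra.Bundles using (CommutativeMonoid)
open import Data.Bool using (Bool; true; false; _∧_)
open import Data.Fin using (Fin)
open import Data.Integer as ℤ using (+_)
import Data.Integer.Properties as ℤP
open import Data.List using ([]; _∷_; filter; length; allFin)
open import Data.Nat as ℕ using (ℕ; zero; suc; _+_; _*_; NonZero; _≤_; _<_; z≤n)
import Data.Nat.Properties as ℕP
open import Data.Nat.Tactic.RingSolver using (solve-∀)
open import Data.Rational as ℚ using (ℚ; 0ℚ; toℚᵘ)
import Data.Rational.Properties as ℚP
open import Data.Rational.Unnormalised as ℚᵘ using (mkℚᵘ)
import Data.Rational.Unnormalised.Properties as ℚᵘP
open import Data.Sign using (Sign)
import Data.Sign.Properties as SignP
open import Data.Sum using (inj₁; inj₂)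
open import Relation.Binary.PropositionalEquality
open import Relation.Nullary.Decidable using (does; dec-true; dec-false)
open import Relation.Unary using (Pred; Decidable)
open import Algebra.Properties.AbelianGroup ℚP.+-0-abelianGroup
  using (xyx⁻¹≈y; ⁻¹-anti-homo‿-)
open import Algebra.Properties.CommutativeSemigroup ℕP.+-commutativeSemigroup
  using (interchange)
open import Algebra.Properties.CommutativeSemigroup
  (CommutativeMonoid.commutativeSemigroup ℚP.+-0-commutativeMonoid) using (xy∙z≈xz∙y)

toℚᵘ-frac : ∀ p q → toℚᵘ (frac p (suc q)) ℚᵘ.≃ mkℚᵘ (+ p) q
toℚᵘ-frac p q = ℚP.toℚᵘ-fromℚᵘ (mkℚᵘ (+ p) q)

frac0≡0 : ∀ q → frac 0 q ≡ 0ℚ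
frac0≡0 zero    = refl
frac0≡0 (suc q) = ℚP.0/n≡0 (suc q)

0≤frac : ∀ p q → 0ℚ ℚ.≤ frac p q
0≤frac p zero    = ℚP.≤-refl
0≤frac p (suc q) = ℚP.nonNegative⁻¹ _ {{ℚP.normalize-nonNeg p (suc q)}}

frac≤frac : ∀ p q r s .{{_ : NonZero s}} → p * s ≤ r * q → frac p q ℚ.≤ frac r s
frac≤frac p zero    r s       _     = 0≤frac r s
frac≤frac p (suc q) r (suc s) ps≤rq = ℚP.toℚᵘ-cancel-≤
  (ℚᵘP.≤-respˡ-≃ (ℚᵘP.≃-sym (toℚᵘ-frac p q)) (ℚᵘP.≤-respʳ-≃ (ℚᵘP.≃-sym (toℚᵘ-frac r s))
    (ℚᵘ.*≤* (subst₂ ℤ._≤_ (ℤP.pos-* p (suc s)) (ℤP.pos-* r (suc q)) (ℤ.+≤+ ps≤rq)))))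

frac+frac : ∀ p q r s .{{_ : NonZero q}} .{{_ : NonZero s}} →
            frac p q ℚ.+ frac r s ≡ frac (p * s + r * q) (q * s)
frac+frac p (suc q) r (suc s) = ℚP.toℚᵘ-injective (begin
  toℚᵘ (frac p (suc q) ℚ.+ frac r (suc s))
    ≈⟨ ℚP.toℚᵘ-homo-+ (frac p (suc q)) (frac r (suc s)) ⟩
  toℚᵘ (frac p (suc q)) ℚᵘ.+ toℚᵘ (frac r (suc s))
    ≈⟨ ℚᵘP.+-cong (toℚᵘ-frac p q) (toℚᵘ-frac r s) ⟩
  mkℚᵘ (+ p) q ℚᵘ.+ mkℚᵘ (+ r) s
    ≡⟨ cong (λ n → mkℚᵘ n (s + q * suc s)) numerator ⟩
  mkℚᵘ (+ (p * suc s + r * suc q)) (s + q * suc s)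
    ≈⟨ toℚᵘ-frac _ _ ⟨
  toℚᵘ (frac (p * suc s + r * suc q) (suc q * suc s)) ∎)
  where
  open ℚᵘP.≃-Reasoning
  numerator : + p ℤ.* + suc s ℤ.+ + r ℤ.* + suc q ≡ + (p * suc s + r * suc q)
  numerator = trans (cong₂ ℤ._+_ (sym (ℤP.pos-* p (suc s))) (sym (ℤP.pos-* r (suc q))))
                    (sym (ℤP.pos-+ (p * suc s) (r * suc q)))

m+k≡n⇒m≤n : ∀ {m n} k → m + k ≡ n → m ≤ n
m+k≡n⇒m≤n {m} k refl = ℕP.m≤m+n m k

nonZero-mono : ∀ {m n} → m ≤ n → .{{NonZero m}} → NonZero n
nonZero-mono {m} m≤n = ℕ.>-nonZero (ℕP.<-≤-trans (ℕ.>-nonZero⁻¹ m) m≤n)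

weightedGini : ℕ → ℕ → ℕ → ℚ
weightedGini m a b = frac (2 * a * b) (m * (a + b))

weightedGini-mono-nonEmpty : ∀ m .{{_ : NonZero m}} a b p q .{{_ : NonZero (a + b)}} →
                             weightedGini m a b ℚ.≤ weightedGini m (a + p) (b + q)
weightedGini-mono-nonEmpty m a b p q =
  frac≤frac (2 * a * b) (m * (a + b)) (2 * (a + p) * (b + q)) (m * (a + p + (b + q)))
            (m+k≡n⇒m≤n _ (gap m a b p q))
  where
  instance
    _ : NonZero (a + p + (b + q))
    _ = nonZero-mono (ℕP.+-mono-≤ (ℕP.m≤m+n a p) (ℕP.m≤m+n b q))
    _ : NonZero (m * (a + p + (b + q)))
    _ = ℕP.m*n≢0 m _
  gap : ∀ m a b p q →
    2 * a * b * (m * (a + p + (b + q))) + 2 * m * (a * a * q + b * b * p + p * q * (a + b))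
    ≡ 2 * (a + p) * (b + q) * (m * (a + b))
  gap = solve-∀

weightedGini-mono : ∀ m .{{_ : NonZero m}} a b p q →
                    weightedGini m a b ℚ.≤ weightedGini m (a + p) (b + q)
weightedGini-mono m zero    zero    p q =
  subst (ℚ._≤ weightedGini m p q) (sym (frac0≡0 (m * 0))) (0≤frac (2 * p * q) (m * (p + q)))
weightedGini-mono m zero    (suc b) p q = weightedGini-mono-nonEmpty m zero (suc b) p q
weightedGini-mono m (suc a) b       p q = weightedGini-mono-nonEmpty m (suc a) b p q

weightedGini-lipschitz-nonEmpty : ∀ m .{{_ : NonZero m}} a b p q .{{_ : NonZero (a + b)}} →
  weightedGini m (a + p) (b + q) ℚ.≤ weightedGini m a b ℚ.+ frac (2 * (p + q)) m
weightedGini-lipschitz-nonEmpty m a b p q = begin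
  weightedGini m (a + p) (b + q)
    ≤⟨ frac≤frac (2 * (a + p) * (b + q)) (m * (a + p + (b + q))) bound (m * (a + b) * m)
                 (m+k≡n⇒m≤n _ (gap m a b p q)) ⟩
  frac bound (m * (a + b) * m)
    ≡⟨ frac+frac (2 * a * b) (m * (a + b)) (2 * (p + q)) m ⟨
  weightedGini m a b ℚ.+ frac (2 * (p + q)) m ∎
  where
  open ℚP.≤-Reasoning
  instance
    _ : NonZero (m * (a + b))
    _ = ℕP.m*n≢0 m _
    _ : NonZero (m * (a + b) * m)
    _ = ℕP.m*n≢0 (m * (a + b)) m
  bound : ℕ
  bound = 2 * a * b * m + 2 * (p + q) * (m * (a + b))
  gap : ∀ m a b p q →
    2 * (a + p) * (b + q) * (m * (a + b) * m)
      + 2 * m * m * (q * (b * b + 2 * a * b) + p * (a * a + 2 * a * b)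
                     + (p * p + p * q + q * q) * (a + b))
    ≡ (2 * a * b * m + 2 * (p + q) * (m * (a + b))) * (m * (a + p + (b + q)))
  gap = solve-∀

weightedGini-lipschitz : ∀ m .{{_ : NonZero m}} a b p q →
  weightedGini m (a + p) (b + q) ℚ.≤ weightedGini m a b ℚ.+ frac (2 * (p + q)) m
weightedGini-lipschitz m zero    zero    p q = begin
  weightedGini m p q
    ≤⟨ frac≤frac (2 * p * q) (m * (p + q)) (2 * (p + q)) m (m+k≡n⇒m≤n _ (gap m p q)) ⟩
  frac (2 * (p + q)) m
    ≡⟨ ℚP.+-identityˡ _ ⟨
  0ℚ ℚ.+ frac (2 * (p + q)) m
    ≡⟨ cong (ℚ._+ frac (2 * (p + q)) m) (frac0≡0 (m * 0)) ⟨
  weightedGini m 0 0 ℚ.+ frac (2 * (p + q)) m ∎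
  where
  open ℚP.≤-Reasoning
  gap : ∀ m p q → 2 * p * q * m + 2 * m * (p * p + p * q + q * q) ≡ 2 * (p + q) * (m * (p + q))
  gap = solve-∀
weightedGini-lipschitz m zero    (suc b) p q = weightedGini-lipschitz-nonEmpty m zero (suc b) p q
weightedGini-lipschitz m (suc a) b       p q = weightedGini-lipschitz-nonEmpty m (suc a) b p q

p≤q+r⇒p-q≤r : ∀ {p q r} → p ℚ.≤ q ℚ.+ r → p ℚ.- q ℚ.≤ r
p≤q+r⇒p-q≤r {p} {q} {r} p≤q+r =
  subst (p ℚ.- q ℚ.≤_) (xyx⁻¹≈y q r) (ℚP.+-monoˡ-≤ (ℚ.- q) p≤q+r)

∣p-q∣≤r : ∀ {p q r} → p ℚ.≤ q ℚ.+ r → q ℚ.≤ p ℚ.+ r → ℚ.∣ p ℚ.- q ∣ ℚ.≤ r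
∣p-q∣≤r {p} {q} {r} p≤q+r q≤p+r with ℚP.∣p∣≡p∨∣p∣≡-p (p ℚ.- q)
... | inj₁ ∣p-q∣≡p-q = subst (ℚ._≤ r) (sym ∣p-q∣≡p-q) (p≤q+r⇒p-q≤r p≤q+r)
... | inj₂ ∣p-q∣≡q-p =
  subst (ℚ._≤ r) (sym (trans ∣p-q∣≡q-p (⁻¹-anti-homo‿- p q))) (p≤q+r⇒p-q≤r q≤p+r)

∣[p+q′]-[p′+q]∣≤r : ∀ {p p′ q q′ r} → p ℚ.≤ p′ → p′ ℚ.≤ p ℚ.+ r → q ℚ.≤ q′ → q′ ℚ.≤ q ℚ.+ r →
                    ℚ.∣ (p ℚ.+ q′) ℚ.- (p′ ℚ.+ q) ∣ ℚ.≤ r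
∣[p+q′]-[p′+q]∣≤r {p} {p′} {q} {q′} {r} p≤p′ p′≤p+r q≤q′ q′≤q+r = ∣p-q∣≤r
  (begin
    p ℚ.+ q′        ≤⟨ ℚP.+-mono-≤ p≤p′ q′≤q+r ⟩
    p′ ℚ.+ (q ℚ.+ r) ≡⟨ ℚP.+-assoc p′ q r ⟨
    p′ ℚ.+ q ℚ.+ r   ∎)
  (begin
    p′ ℚ.+ q         ≤⟨ ℚP.+-mono-≤ p′≤p+r q≤q′ ⟩
    p ℚ.+ r ℚ.+ q′   ≡⟨ xy∙z≈xz∙y p r q′ ⟩
    p ℚ.+ q′ ℚ.+ r   ∎)
  where open ℚP.≤-Reasoning

indicator : Bool → ℕ
indicator true  = 1
indicator false = 0

length-filter-∷ : ∀ {a p} {A : Set a} {P : Pred A p} (P? : Decidable P) x xs →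
                  length (filter P? (x ∷ xs)) ≡ indicator (does (P? x)) + length (filter P? xs)
length-filter-∷ P? x xs with does (P? x)
... | true  = refl
... | false = refl

length-filter-partition : ∀ {a p q r} {A : Set a} {P : Pred A p} {Q : Pred A q} {R : Pred A r}
  (P? : Decidable P) (Q? : Decidable Q) (R? : Decidable R) →
  (∀ x → indicator (does (P? x)) ≡ indicator (does (Q? x)) + indicator (does (R? x))) →
  ∀ xs → length (filter P? xs) ≡ length (filter Q? xs) + length (filter R? xs)
length-filter-partition P? Q? R? split []       = refl
length-filter-partition P? Q? R? split (x ∷ xs) = begin
  length (filter P? (x ∷ xs))
    ≡⟨ length-filter-∷ P? x xs ⟩
  indicator (does (P? x)) + length (filter P? xs)
    ≡⟨ cong₂ _+_ (split x) (length-filter-partition P? Q? R? split xs) ⟩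
  ([Q] + [R]) + (#Q + #R)
    ≡⟨ interchange [Q] [R] #Q #R ⟩
  ([Q] + #Q) + ([R] + #R)
    ≡⟨ cong₂ _+_ (length-filter-∷ Q? x xs) (length-filter-∷ R? x xs) ⟨
  length (filter Q? (x ∷ xs)) + length (filter R? (x ∷ xs)) ∎
  where
  open ≡-Reasoning
  [Q] [R] #Q #R : ℕ
  [Q] = indicator (does (Q? x))
  [R] = indicator (does (R? x))
  #Q  = length (filter Q? xs)
  #R  = length (filter R? xs)

indicator-interval-split : ∀ {lo mid hi} → lo ≤ mid → mid ≤ hi → ∀ v b →
  indicator (does (lo ℕ.<? v) ∧ does (v ℕ.≤? hi) ∧ b)
    ≡ indicator (does (lo ℕ.<? v) ∧ does (v ℕ.≤? mid) ∧ b)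
      + indicator (does (mid ℕ.<? v) ∧ does (v ℕ.≤? hi) ∧ b)
indicator-interval-split {lo} {mid} {hi} lo≤mid mid≤hi v b with ℕP.≤-<-connex v mid
... | inj₁ v≤mid
  rewrite dec-true (v ℕ.≤? mid) v≤mid | dec-false (mid ℕ.<? v) (ℕP.≤⇒≯ v≤mid)
        | dec-true (v ℕ.≤? hi) (ℕP.≤-trans v≤mid mid≤hi)
  = sym (ℕP.+-identityʳ _)
... | inj₂ mid<v
  rewrite dec-false (v ℕ.≤? mid) (ℕP.<⇒≱ mid<v) | dec-true (mid ℕ.<? v) mid<v
        | dec-true (lo ℕ.<? v) (ℕP.≤-<-trans lo≤mid mid<v)
  = refl

indicator-sign-split : ∀ b c s → indicator (b ∧ c)
  ≡ indicator (b ∧ c ∧ does (s SignP.≟ Sign.+)) + indicator (b ∧ c ∧ does (s SignP.≟ Sign.-))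
indicator-sign-split false c     s      = refl
indicator-sign-split true  false s      = refl
indicator-sign-split true  true  Sign.+ = refl
indicator-sign-split true  true  Sign.- = refl

countIn-split : ∀ {m} (x : Fin m → ℕ) (y : Fin m → Sign) s {lo mid hi} → lo ≤ mid → mid ≤ hi →
                countIn x y s lo hi ≡ countIn x y s lo mid + countIn x y s mid hi
countIn-split {m} x y s lo≤mid mid≤hi = length-filter-partition _ _ _
  (λ i → indicator-interval-split lo≤mid mid≤hi (x i) (does (y i SignP.≟ s))) (allFin m)

countPts≡countIn⁺+countIn⁻ : ∀ {m} (x : Fin m → ℕ) (y : Fin m → Sign) lo hi →
                             countPts x lo hi ≡ countIn x y Sign.+ lo hi + countIn x y Sign.- lo hi
countPts≡countIn⁺+countIn⁻ {m} x y lo hi = length-filter-partition _ _ _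
  (λ i → indicator-sign-split (does (lo ℕ.<? x i)) (does (x i ℕ.≤? hi)) (y i)) (allFin m)

lemma8 : (m N : ℕ) → .{{_ : NonZero m}} → (x : Fin m → ℕ) → (y : Fin m → Sign) →
         (∀ i → 1 ≤ x i) → (∀ i → x i ≤ N) →
         (j j′ : ℕ) → 1 ≤ j → j < j′ → j′ ≤ N →
         ℚ.∣ giniLoss N x y j ℚ.- giniLoss N x y j′ ∣ ℚ.≤ frac (2 ℕ.* countPts x j j′) m
lemma8 m N x y _ _ j j′ _ j<j′ j′≤N = begin
  ℚ.∣ giniLoss N x y j ℚ.- giniLoss N x y j′ ∣
    ≡⟨ cong₂ (λ L L′ → ℚ.∣ L ℚ.- L′ ∣) loss-at-j loss-at-j′ ⟩
  ℚ.∣ (G a b ℚ.+ G (c + p) (d + q)) ℚ.- (G (a + p) (b + q) ℚ.+ G c d) ∣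
    ≤⟨ ∣[p+q′]-[p′+q]∣≤r (weightedGini-mono m a b p q) (weightedGini-lipschitz m a b p q)
                         (weightedGini-mono m c d p q) (weightedGini-lipschitz m c d p q) ⟩
  frac (2 * (p + q)) m
    ≡⟨ cong (λ ℓ → frac (2 * ℓ) m) (countPts≡countIn⁺+countIn⁻ x y j j′) ⟨
  frac (2 * countPts x j j′) m ∎
  where
  open ℚP.≤-Reasoning
  G : ℕ → ℕ → ℚ
  G = weightedGini m
  a b p q c d : ℕ
  a = countIn x y Sign.+ 0 j
  b = countIn x y Sign.- 0 j
  p = countIn x y Sign.+ j j′
  q = countIn x y Sign.- j j′
  c = countIn x y Sign.+ j′ N
  d = countIn x y Sign.- j′ N
  j≤j′ : j ≤ j′
  j≤j′ = ℕP.<⇒≤ j<j′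
  loss-at-j : giniLoss N x y j ≡ G a b ℚ.+ G (c + p) (d + q)
  loss-at-j = cong₂ (λ c′ d′ → G a b ℚ.+ G c′ d′)
    (trans (countIn-split x y Sign.+ j≤j′ j′≤N) (ℕP.+-comm p c))
    (trans (countIn-split x y Sign.- j≤j′ j′≤N) (ℕP.+-comm q d))
  loss-at-j′ : giniLoss N x y j′ ≡ G (a + p) (b + q) ℚ.+ G c d
  loss-at-j′ = cong₂ (λ a′ b′ → G a′ b′ ℚ.+ G c d)
    (countIn-split x y Sign.+ z≤n j≤j′) (countIn-split x y Sign.- z≤n j≤j′)
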